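{- Let $(S,\tau)$ be a topological space and $\langle A_i: i<\lambda\rangle$ a pseudo-stratification of $S$ of length $\lambda\le\omega$. Then there exists a sequence $\langle U_i: i<\lambda\rangle$ of open sets such that (1) $U_i\cap\overline{A_i}=A_i$ for all $i<\lambda$; (2) if $j<i<\lambda$ and $U_i\cap A_j\ne\emptyset$, then $A_i\subseteq\overline{A_j}$.
   Context: A subset is locally closed if it is the intersection of an open set and a closed set; $\overline{X}$ denotes closure. A pseudo-stratification is a finite or $\omega$-long sequence $\langle A_i: i<\lambda\rangle$ ($\lambda\in\omega\cup\{\omega\}$) of locally closed sets that form a partition of $S$ and satisfy: if $j<i$ then either $A_i\cap\overline{A_j}=\emptyset$ or $A_i\subseteq\overline{A_j}$. -}

module Defs where

open import Level using (0ℓ; suc)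
open import Data.Nat using (ℕ; _<_)
open import Data.Fin using (Fin; toℕ)
open import Data.Unit using (⊤)
open import Data.Product using (Σ; ∃; ∃₂; _×_; _,_)
open import Data.Sum using (_⊎_)
open import Relation.Binary.PropositionalEquality using (_≡_)
open import Relation.Unary using (Pred; _∈_; _⊆_; _∩_; ∁; _≐_; Satisfiable; Empty)

-- A topological space: a carrier with a family of open subsets (subsets are
-- predicates), containing the whole space, closed under binary intersections
-- and arbitrary unions, and invariant under extensional equality of subsets.
-- (The empty set is open as the union of the empty family.)
record TopologicalSpace : Set₁ where
  field
    Carrier  : Set
    IsOpen   : Pred (Pred Carrier 0ℓ) 0ℓ
    open-resp : ∀ {U V} → U ≐ V → IsOpen U → IsOpen V
    open-univ : IsOpen (λ _ → ⊤)
    open-∩    : ∀ {U V} → IsOpen U → IsOpen V → IsOpen (U ∩ V)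
    open-⋃    : {I : Set} (U : I → Pred Carrier 0ℓ) →
                (∀ i → IsOpen (U i)) → IsOpen (λ x → ∃ λ i → x ∈ U i)

module _ (T : TopologicalSpace) where
  open TopologicalSpace T

  IsClosed : Pred Carrier 0ℓ → Set
  IsClosed F = IsOpen (∁ F)

  closure : Pred Carrier 0ℓ → Pred Carrier (suc 0ℓ)
  closure A x = ∀ U → IsOpen U → x ∈ U → Satisfiable (U ∩ A)

  LocallyClosed : Pred Carrier 0ℓ → Set₁
  LocallyClosed A = ∃₂ λ U F → IsOpen U × IsClosed F × (A ≐ (U ∩ F))

data Length : Set where
  fin : ℕ → Length
  ω   : Length

Idx : Length → Set
Idx (fin n) = Fin n
Idx ω       = ℕ

ix : ∀ {L} → Idx L → ℕ
ix {fin n} i = toℕ i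
ix {ω}     i = i

module _ (T : TopologicalSpace) where
  open TopologicalSpace T

  IsPseudoStratification : (L : Length) → (Idx L → Pred Carrier 0ℓ) → Set₁
  IsPseudoStratification L A =
      (∀ i → LocallyClosed T (A i))
    × (∀ x → ∃ λ i → x ∈ A i)
    × (∀ i j x → x ∈ A i → x ∈ A j → i ≡ j)
    × (∀ i j → ix j < ix i →
         Empty (A i ∩ closure T (A j)) ⊎ (A i ⊆ closure T (A j)))

-- Take U_i to be the open part of a decomposition A_i = V_i ∩ F_i (F_i closed),
-- minus the closures of those earlier strata A_j whose closure misses A_i. Only
-- finitely many j < i exist, so U_i is open. As cl A_i ⊆ F_i, U_i ∩ cl A_i = A_i;
-- and if U_i meets A_j with j < i, then cl A_j meets A_i, so the frontier
-- condition forces A_i ⊆ cl A_j.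
module Submission where

open import Defs
open import Level using (0ℓ; suc; lift; lower)
open import Function using (_∘_; id)
open import Data.Nat using (ℕ; zero; _<_)
open import Data.Nat.Properties using (m<n⇒m<1+n; n<1+n; m<1+n⇒m<n∨m≡n)
open import Data.Fin.Properties using (toℕ-injective)
open import Data.Product using (∃; _×_; _,_; proj₁; proj₂; Σ; uncurry)
open import Data.Sum using (inj₁; inj₂)
open import Data.Unit using (tt)
open import Data.Empty using (⊥-elim)
open import Relation.Nullary using (¬_; yes; no)
open import Relation.Nullary.Decidable using (True; toWitness; fromWitness; map′)
open import Relation.Binary.PropositionalEquality using (_≡_; sym; trans; subst)
open import Relation.Unary using (Pred; _∈_; _⊆_; _∩_; _≐_; ⋂; ⋃; Satisfiable; Empty; ∁)
open import Axiom.ExcludedMiddle using (ExcludedMiddle)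
open import Axiom.DoubleNegationElimination using (em⇒dne)

ix-injective : ∀ {L} {i j : Idx L} → ix i ≡ ix j → i ≡ j
ix-injective {fin n} = toℕ-injective
ix-injective {ω}     = id

module _ (T : TopologicalSpace) where
  open TopologicalSpace T

  ⊆-closure : ∀ {A} → A ⊆ closure T A
  ⊆-closure {x = x} a W _ x∈W = x , x∈W , a

module Classical (em : ExcludedMiddle (suc 0ℓ)) where

  em₀ : ExcludedMiddle 0ℓ
  em₀ = map′ lower lift em

  -- Squashes a proposition of Set₁ (such as membership in a closure) into Set.
  ⌊_⌋ : Set₁ → Set
  ⌊ P ⌋ = True (em {P})

  module _ (T : TopologicalSpace) where
    open TopologicalSpace T

    exterior : Pred Carrier 0ℓ → Pred Carrier 0ℓ
    exterior A x = ⌊ ¬ closure T A x ⌋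

    ¬closure⇒disjoint-nbhd : ∀ {A x} → ¬ closure T A x →
                             ∃ λ W → IsOpen W × x ∈ W × Empty (W ∩ A)
    ¬closure⇒disjoint-nbhd ¬x∈clA = em⇒dne em λ ∄W →
      ¬x∈clA λ W oW x∈W → em⇒dne em₀ λ W∩A-empty →
        ∄W (W , oW , x∈W , λ y y∈W∩A → W∩A-empty (y , y∈W∩A))

    -- The exterior is the union, over its points, of neighbourhoods disjoint from A.
    exterior-open : ∀ A → IsOpen (exterior A)
    exterior-open A = open-resp (⋃⊆ext , ext⊆⋃) (open-⋃ nbhd (proj₁ ∘ proj₂ ∘ separate))
      where
      separate : (p : Σ Carrier (exterior A)) → ∃ λ W → IsOpen W × proj₁ p ∈ W × Empty (W ∩ A)
      separate (x , x∈ext) = ¬closure⇒disjoint-nbhd (toWitness x∈ext)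
      nbhd : Σ Carrier (exterior A) → Pred Carrier 0ℓ
      nbhd = proj₁ ∘ separate
      ⋃⊆ext : ⋃ _ nbhd ⊆ exterior A
      ⋃⊆ext (p , y∈W) with separate p
      ... | W , oW , _ , W∩A-empty = fromWitness λ y∈clA → uncurry W∩A-empty (y∈clA W oW y∈W)
      ext⊆⋃ : exterior A ⊆ ⋃ _ nbhd
      ext⊆⋃ {y} y∈ext = (y , y∈ext) , proj₁ (proj₂ (proj₂ (separate (y , y∈ext))))

    closure-least : ∀ {A F} → IsClosed T F → A ⊆ F → closure T A ⊆ F
    closure-least {A} {F} cF A⊆F {x} x∈clA with em₀ {F x}
    ... | yes x∈F = x∈F
    ... | no  x∉F with x∈clA (∁ F) cF x∉F
    ...   | _ , y∉F , y∈A = ⊥-elim (y∉F (A⊆F y∈A))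

    ⋂-const-open : {I : Set} (U : I → Pred Carrier 0ℓ) → (∀ a → IsOpen (U a)) →
                   (∀ a b → U a ⊆ U b) → IsOpen (⋂ I U)
    ⋂-const-open {I} U oU U-const with em₀ {I}
    ... | yes a = open-resp ((λ x∈Ua b → U-const a b x∈Ua) , (λ x∈⋂ → x∈⋂ a)) (oU a)
    ... | no ∄a = open-resp ((λ _ a → ⊥-elim (∄a a)) , (λ _ → tt)) open-univ

    ⋂-below-open : {I : Set} (r : I → ℕ) → (∀ {a b} → r a ≡ r b → a ≡ b) →
                   (U : I → Pred Carrier 0ℓ) → (∀ a → IsOpen (U a)) →
                   ∀ k → IsOpen (λ x → ∀ a → r a < k → U a x)
    ⋂-below-open r r-inj U oU zero = open-resp ((λ _ _ ()) , (λ _ → tt)) open-univ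
    ⋂-below-open {I} r r-inj U oU (ℕ.suc k) =
      open-resp (split , join) (open-∩ (⋂-below-open r r-inj U oU k) fibre-open)
      where
      fibre : Pred Carrier 0ℓ
      fibre = ⋂ (∃ λ a → r a ≡ k) (U ∘ proj₁)
      fibre-open : IsOpen fibre
      fibre-open = ⋂-const-open (U ∘ proj₁) (oU ∘ proj₁)
        λ (a , ra≡k) (b , rb≡k) → subst (λ c → U a ⊆ U c) (r-inj (trans ra≡k (sym rb≡k))) id
      split : (λ x → ∀ a → r a < k → U a x) ∩ fibre ⊆ (λ x → ∀ a → r a < ℕ.suc k → U a x)
      split (below , in-fibre) a ra<1+k with m<1+n⇒m<n∨m≡n ra<1+k
      ... | inj₁ ra<k = below a ra<k
      ... | inj₂ ra≡k = in-fibre (a , ra≡k)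
      join : (λ x → ∀ a → r a < ℕ.suc k → U a x) ⊆ (λ x → ∀ a → r a < k → U a x) ∩ fibre
      join below = (λ a ra<k → below a (m<n⇒m<1+n ra<k))
                 , (λ (a , ra≡k) → below a (subst (_< ℕ.suc k) (sym ra≡k) (n<1+n k)))

module Construction (em : ExcludedMiddle (suc 0ℓ)) (T : TopologicalSpace) {L : Length}
    {A : Idx L → Pred (TopologicalSpace.Carrier T) 0ℓ}
    (ps : IsPseudoStratification T L A) where
  open TopologicalSpace T
  open Classical em

  separated : Idx L → Idx L → Set
  separated i j = ⌊ Empty (A i ∩ closure T (A j)) ⌋

  nbhd : Idx L → Pred Carrier 0ℓ
  nbhd i = proj₁ (proj₁ ps i)
         ∩ (λ x → ∀ j → ix j < ix i → ⋂ (separated i j) (λ _ → exterior T (A j)) x)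

  nbhd-open : ∀ i → IsOpen (nbhd i)
  nbhd-open i = open-∩ (proj₁ (proj₂ (proj₂ (proj₁ ps i))))
    (⋂-below-open T ix ix-injective _
      (λ j → ⋂-const-open T _ (λ _ → exterior-open T (A j)) (λ _ _ x∈ext → x∈ext)) (ix i))

  nbhd-∩-closure : ∀ i → (nbhd i ∩ closure T (A i)) ≐ A i
  nbhd-∩-closure i =
    let _ , _ , _ , cF , A⊆V∩F , V∩F⊆A = proj₁ ps i in
      (λ ((x∈V , _) , x∈clA) → V∩F⊆A (x∈V , closure-least T cF (proj₂ ∘ A⊆V∩F) x∈clA))
    , (λ {x} x∈A → ( proj₁ (A⊆V∩F x∈A)
                   , λ j _ sep → fromWitness λ x∈clAj → toWitness sep x (x∈A , x∈clAj))
                 , ⊆-closure T x∈A)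

  nbhd-meets⇒⊆closure : ∀ i j → ix j < ix i → Satisfiable (nbhd i ∩ A j) →
                        A i ⊆ closure T (A j)
  nbhd-meets⇒⊆closure i j j<i (x , (_ , x∈ext) , x∈Aj) with proj₂ (proj₂ (proj₂ ps)) i j j<i
  ... | inj₂ Aᵢ⊆clAⱼ = Aᵢ⊆clAⱼ
  ... | inj₁ Aᵢ∩clAⱼ-empty =
    ⊥-elim (toWitness (x∈ext j j<i (fromWitness Aᵢ∩clAⱼ-empty)) (⊆-closure T x∈Aj))

lemma1 : ExcludedMiddle (suc 0ℓ) →
    (T : TopologicalSpace) (L : Length)
    (A : Idx L → Pred (TopologicalSpace.Carrier T) 0ℓ) →
    IsPseudoStratification T L A →
    ∃ λ (U : Idx L → Pred (TopologicalSpace.Carrier T) 0ℓ) →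
    (∀ i → TopologicalSpace.IsOpen T (U i))
    × (∀ i → (U i ∩ closure T (A i)) ≐ A i)
    × (∀ i j → ix j < ix i → Satisfiable (U i ∩ A j) → A i ⊆ closure T (A j))
lemma1 em T L A ps = nbhd , nbhd-open , nbhd-∩-closure , nbhd-meets⇒⊆closure
  where open Construction em T ps
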